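{- Let $X$ be a real normed space, let $n \geq 1$, and let $f \colon \{ -1,1\}^{n} \to X$ be a function of degree $\deg(f)$. Let $m \geq 2$ be an even integer such that $$\deg(f) \leq \frac{n}{m} - \frac{1}{2}.$$ Then for every $S \subset \{1,\ldots,n\}$ with $|S| = \deg(f)$ there exist a probability measure $\mu$ supported on $W(m)$ and a function $h \colon W(m) \to \{ -1,1\}$ such that $$\widehat{f}(S) = \int_{W(m)} h(x) f(x)\, d\mu(x).$$ Moreover, $\mu$ and $h$ depend only on $S$, $m$, $\deg(f)$ and $n$ (and not otherwise on $f$).
   Context: Every function $f\colon \{ -1,1\}^{n} \to X$ ($X$ a normed space) has a unique Fourier–Walsh representation $f(x) = \sum_{S \subset \{1,\ldots,n\}} \widehat{f}(S) x^{S}$ with $\widehat{f}(S) \in X$, where $x^{S} = \prod_{j \in S} x_{j}$ and $x^{\emptyset} = 1$. The degree $\deg(f)$ is the largest $|S|$ with $\widehat{f}(S) \neq 0$ (so $\widehat f(S)=0$ whenever $|S|>\deg(f)$). For an integer $m > 1$, $W(m)$ denotes the set of points $x = (x_{1},\ldots,x_{n}) \in \{ -1,1\}^{n}$ such that the number $\#\{j : x_{j} = -1\}$ is divisible by $m$. -}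

module Defs where

open import Level using (Level)
open import Data.Bool using (Bool; true; false)
open import Data.Nat as ℕ using (ℕ; zero; suc)
open import Data.Nat.Divisibility using (_∣_)
open import Data.Vec using (Vec; []; _∷_)
open import Data.List using (List; []; _∷_; _++_; map; foldr)
open import Data.Fin.Subset using (Subset; _∩_; ∣_∣)
open import Data.Rational using (ℚ; 0ℚ; 1ℚ; ½; -_; _+_; _*_)
open import Data.Rational.Properties using (+-*-commutativeRing)
open import Data.Product using (Σ; ∃; _×_)
open import Relation.Nullary using (¬_)
open import Relation.Binary.PropositionalEquality using (_≡_)
open import Algebra.Module.Bundles using (Module)

-- A point x ∈ {-1,1}^n is a Vec Bool n, with  true ↔ x_j = -1,  false ↔ x_j = 1.
Point : ℕ → Set
Point n = Vec Bool n

signℚ : Bool → ℚ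
signℚ true  = - 1ℚ
signℚ false = 1ℚ

negOnePow : ℕ → ℚ
negOnePow zero    = 1ℚ
negOnePow (suc k) = - negOnePow k

halfPow : ℕ → ℚ
halfPow zero    = 1ℚ
halfPow (suc k) = ½ * halfPow k

points : (n : ℕ) → List (Point n)
points zero    = [] ∷ []
points (suc n) = map (true ∷_) (points n) ++ map (false ∷_) (points n)

-- x^S = ∏_{j∈S} x_j = (-1)^{#{j ∈ S : x_j = -1}}
chi : ∀ {n} → Subset n → Point n → ℚ
chi S x = negOnePow ∣ S ∩ x ∣

InW : ∀ {n} → ℕ → Point n → Set
InW m x = m ∣ ∣ x ∣

sumℚ : ∀ n → (Point n → ℚ) → ℚ
sumℚ n g = foldr (λ x acc → g x + acc) 0ℚ (points n)

ℚring = +-*-commutativeRing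

module _ {c ℓ : Level} (M : Module ℚring c ℓ) where
  open Module M

  sumᴹ : ∀ n → (Point n → Carrierᴹ) → Carrierᴹ
  sumᴹ n g = foldr (λ x acc → g x +ᴹ acc) 0ᴹ (points n)

  fourier : ∀ {n} → (Point n → Carrierᴹ) → Subset n → Carrierᴹ
  fourier {n} f S = halfPow n *ₗ sumᴹ n (λ x → chi S x *ₗ f x)

  HasDegree : ∀ {n} → (Point n → Carrierᴹ) → ℕ → Set ℓ
  HasDegree {n} f d =
    (∀ (T : Subset n) → d ℕ.< ∣ T ∣ → fourier f T ≈ᴹ 0ᴹ)
    × ∃ λ (T : Subset n) → (∣ T ∣ ≡ d) × ¬ (fourier f T ≈ᴹ 0ᴹ)

{-# OPTIONS --safe #-}
-- Expanding f in the Walsh basis shows f̂(S) = ∑ₓ ν(x) f(x) for every ν : {-1,1}ⁿ → ℚ whose moments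
-- ∑ₓ ν(x) x^T equal [T = S] for all |T| ≤ deg f, so it suffices to build such a ν = μ·h with μ a
-- probability measure on W(m).
--
-- Let m = 2K. On {-1,1}^(2K-1) there is a probability measure ρ carried by the points with 0 or K
-- coordinates -1 and whose coordinates all have mean 0. On a block of m coordinates put
-- ν_B(s, c) = s·½ρ(s·c): its moments are [T = {first coordinate}] for |T| ≤ 1, the weight (number
-- of -1's) of every point it charges is ≡ 0 or K mod m, and it has total mass 0 on each of these two
-- classes. Chain d blocks, each one depending on the weight class accumulated before it, and close
-- with r ≥ K further coordinates (possible as n ≥ dm + K) carrying 0 or K entries -1 so that the
-- total weight is ≡ 0 mod m. For S the set of first coordinates of the blocks and T = T_B ∪ T′ split
-- along the first block, either |T′| < d and the moment factorises, or T_B = ∅ and the class balance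
-- of ν_B kills it. Permuting coordinates then moves S to an arbitrary set of size d.
module Submission where

open import Defs
open import Level using (Level)
open import Function using (_∘_)
open import Algebra.Bundles using (CommutativeMonoid)
open import Algebra.Module.Bundles using (Module)
open import Algebra.Module.Construct.TensorUnit using (⟨module⟩)
open import Data.Bool using (Bool; true; false; _∧_; _xor_)
open import Data.Bool.Properties using (not-involutive)
open import Data.Nat as ℕ using (ℕ; zero; suc)
import Data.Nat.Properties as ℕ
open import Data.Fin using (Fin; zero; suc)
open import Data.Fin.Subset using (Subset; ∣_∣; _∩_; ∁; ⊥; ⁅_⁆)
open import Data.Fin.Subset.Properties using (∣⊥∣≡0; ∣⁅x⁆∣≡1; ∣p∣≤n)
open import Data.List using (List; []; _∷_; foldr; map) renaming (_++_ to _++ˡ_)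
open import Data.Vec using (Vec; []; _∷_; _++_; take; drop)
open import Data.Vec.Properties using (take++drop≡id; ++-injectiveˡ; ++-injectiveʳ)
open import Data.Rational using (ℚ; _≤_; nonNegative; Positive; 1/_; 0ℚ; 1ℚ; ½; -_; _+_; _*_; _-_)
import Data.Rational.Properties as ℚ
open import Data.Product using (Σ; _×_; _,_)
open import Relation.Nullary using (¬_; yes; no; contradiction)
open import Relation.Nullary.Decidable using (dec⇒maybe)
open import Tactic.RingSolver using (solve-∀)
open import Data.Nat.Tactic.RingSolver using () renaming (solve-∀ to ℕ-solve-∀)
open import Tactic.RingSolver.Core.AlmostCommutativeRing using (AlmostCommutativeRing; fromCommutativeRing)
open import Data.Nat.Divisibility
  using (_∣_; divides; _∣0; ∣-refl; ∣-reflexive; ∣m∣n⇒∣m+n; ∣m+n∣m⇒∣n)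
open import Data.Sum as ⊎ using (_⊎_; inj₁; inj₂)
open import Relation.Binary.Construct.Closure.ReflexiveTransitive as Star using (Star; _◅_; _◅◅_)
open import Relation.Binary.PropositionalEquality
  using (_≡_; refl; sym; trans; cong; cong₂; subst; module ≡-Reasoning)

private
  variable
    a : Level
    A B : Set a

-- Sums over the cube

data Swap : ℕ → Set where
  here  : ∀ {n} → Swap (suc (suc n))
  there : ∀ {n} → Swap n → Swap (suc n)

swap : ∀ {n} → Swap n → Vec A n → Vec A n
swap here      (x ∷ y ∷ v) = y ∷ x ∷ v
swap (there σ) (x ∷ v)     = x ∷ swap σ v

swap-involutive : ∀ {n} (σ : Swap n) (x : Vec A n) → swap σ (swap σ x) ≡ x
swap-involutive here      (a ∷ b ∷ x) = refl
swap-involutive (there σ) (a ∷ x)     = cong (a ∷_) (swap-involutive σ x)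

module Summation {c ℓ : Level} (CM : CommutativeMonoid c ℓ) where
  open CommutativeMonoid CM
    renaming (Carrier to C; refl to ≈-refl; sym to ≈-sym; trans to ≈-trans)
  open import Algebra.Properties.CommutativeSemigroup commutativeSemigroup using (interchange)

  ∑ : List A → (A → C) → C
  ∑ xs g = foldr (λ x acc → g x ∙ acc) ε xs

  ∑-++ : ∀ (xs ys : List A) g → ∑ (xs ++ˡ ys) g ≈ ∑ xs g ∙ ∑ ys g
  ∑-++ []       ys g = ≈-sym (identityˡ _)
  ∑-++ (x ∷ xs) ys g = ≈-trans (∙-congˡ (∑-++ xs ys g)) (≈-sym (assoc _ _ _))

  ∑-cong : ∀ (xs : List A) {g h} → (∀ x → g x ≈ h x) → ∑ xs g ≈ ∑ xs h
  ∑-cong []       g≈h = ≈-refl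
  ∑-cong (x ∷ xs) g≈h = ∙-cong (g≈h x) (∑-cong xs g≈h)

  ∑-zero : ∀ (xs : List A) {g} → (∀ x → g x ≈ ε) → ∑ xs g ≈ ε
  ∑-zero []       g≈ε = ≈-refl
  ∑-zero (x ∷ xs) g≈ε = ≈-trans (∙-cong (g≈ε x) (∑-zero xs g≈ε)) (identityˡ ε)

  ∑-distrib : ∀ (xs : List A) g h → ∑ xs (λ x → g x ∙ h x) ≈ ∑ xs g ∙ ∑ xs h
  ∑-distrib []       g h = ≈-sym (identityˡ ε)
  ∑-distrib (x ∷ xs) g h = ≈-trans (∙-congˡ (∑-distrib xs g h)) (interchange _ _ _ _)

  ∑-comm : ∀ (xs : List A) (ys : List B) (g : A → B → C) →
           ∑ xs (λ x → ∑ ys (g x)) ≈ ∑ ys (λ y → ∑ xs (λ x → g x y))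
  ∑-comm []       ys g = ≈-sym (∑-zero ys (λ _ → ≈-refl))
  ∑-comm (x ∷ xs) ys g = ≈-trans (∙-congˡ (∑-comm xs ys g)) (≈-sym (∑-distrib ys (g x) _))

  ∑-map : ∀ (f : A → B) (xs : List A) g → ∑ (map f xs) g ≡ ∑ xs (g ∘ f)
  ∑-map f []       g = refl
  ∑-map f (x ∷ xs) g = cong (g (f x) ∙_) (∑-map f xs g)

  ∑-points-suc : ∀ n g →
    ∑ (points (suc n)) g ≈ ∑ (points n) (g ∘ (true ∷_)) ∙ ∑ (points n) (g ∘ (false ∷_))
  ∑-points-suc n g = ≈-trans (∑-++ (map (true ∷_) (points n)) _ g)
    (∙-cong (reflexive (∑-map (true ∷_) (points n) g)) (reflexive (∑-map (false ∷_) (points n) g)))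

  ∑-points-++ : ∀ m n g →
    ∑ (points (m ℕ.+ n)) g ≈ ∑ (points m) (λ u → ∑ (points n) (λ v → g (u ++ v)))
  ∑-points-++ zero    n g = ≈-sym (identityʳ _)
  ∑-points-++ (suc m) n g = ≈-trans (∑-points-suc (m ℕ.+ n) g)
    (≈-trans (∙-cong (∑-points-++ m n (g ∘ (true ∷_))) (∑-points-++ m n (g ∘ (false ∷_))))
      (≈-sym (∑-points-suc m _)))

  ∑-points-∁ : ∀ n g → ∑ (points n) (g ∘ ∁) ≈ ∑ (points n) g
  ∑-points-∁ zero    g = ≈-refl
  ∑-points-∁ (suc n) g = ≈-trans (∑-points-suc n (g ∘ ∁))
    (≈-trans (∙-cong (∑-points-∁ n (g ∘ (false ∷_))) (∑-points-∁ n (g ∘ (true ∷_))))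
      (≈-trans (comm _ _) (≈-sym (∑-points-suc n g))))

  ∑-points-swap : ∀ n (σ : Swap n) g → ∑ (points n) (g ∘ swap σ) ≈ ∑ (points n) g
  ∑-points-swap (suc (suc n)) here g = ≈-trans (split (g ∘ swap here))
    (≈-trans (interchange _ _ _ _) (≈-sym (split g)))
    where
    split : ∀ f → ∑ (points (suc (suc n))) f ≈
      (∑ (points n) (f ∘ (true ∷_) ∘ (true ∷_)) ∙ ∑ (points n) (f ∘ (true ∷_) ∘ (false ∷_))) ∙
      (∑ (points n) (f ∘ (false ∷_) ∘ (true ∷_)) ∙ ∑ (points n) (f ∘ (false ∷_) ∘ (false ∷_)))
    split f = ≈-trans (∑-points-suc (suc n) f) (∙-cong (∑-points-suc n _) (∑-points-suc n _))
  ∑-points-swap (suc n) (there σ) g = ≈-trans (∑-points-suc n (g ∘ swap (there σ)))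
    (≈-trans (∙-cong (∑-points-swap n σ (g ∘ (true ∷_))) (∑-points-swap n σ (g ∘ (false ∷_))))
      (≈-sym (∑-points-suc n g)))

module ℚΣ = Summation ℚ.+-0-commutativeMonoid
open ℚΣ

ℚ-ring : AlmostCommutativeRing _ _
ℚ-ring = fromCommutativeRing ℚ.+-*-commutativeRing (dec⇒maybe ∘ (0ℚ ℚ.≟_))

δᵇ : Bool → Bool → ℚ
δᵇ true  true  = 1ℚ
δᵇ true  false = 0ℚ
δᵇ false true  = 0ℚ
δᵇ false false = 1ℚ

δ : ∀ {n} → Point n → Point n → ℚ
δ []      []      = 1ℚ
δ (a ∷ x) (b ∷ y) = δᵇ a b * δ x y

module ModuleSum {c ℓ : Level} (M : Module ℚring c ℓ) where
  open Module M
  module Σᴹ = Summation +ᴹ-commutativeMonoid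

  *ₗ-∑ : ∀ (xs : List A) r (g : A → Carrierᴹ) → r *ₗ Σᴹ.∑ xs g ≈ᴹ Σᴹ.∑ xs (λ x → r *ₗ g x)
  *ₗ-∑ []       r g = *ₗ-zeroʳ r
  *ₗ-∑ (x ∷ xs) r g = ≈ᴹ-trans (*ₗ-distribˡ r _ _) (+ᴹ-congˡ (*ₗ-∑ xs r g))

  ∑-*ₗ : ∀ (xs : List A) (g : A → ℚ) v → ∑ xs g *ₗ v ≈ᴹ Σᴹ.∑ xs (λ x → g x *ₗ v)
  ∑-*ₗ []       g v = *ₗ-zeroˡ v
  ∑-*ₗ (x ∷ xs) g v = ≈ᴹ-trans (*ₗ-distribʳ v (g x) _) (+ᴹ-congˡ (∑-*ₗ xs g v))

  private
    ∑-1* : ∀ n (w : Point n → ℚ) (g : Point n → Carrierᴹ) →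
           Σᴹ.∑ (points n) (λ x → (1ℚ * w x) *ₗ g x) ≈ᴹ Σᴹ.∑ (points n) (λ x → w x *ₗ g x)
    ∑-1* n w g = Σᴹ.∑-cong (points n) (λ x → *ₗ-congʳ (ℚ.*-identityˡ (w x)))

    ∑-0* : ∀ n (w : Point n → ℚ) (g : Point n → Carrierᴹ) → Σᴹ.∑ (points n) (λ x → (0ℚ * w x) *ₗ g x) ≈ᴹ 0ᴹ
    ∑-0* n w g = Σᴹ.∑-zero (points n) (λ x → ≈ᴹ-trans (*ₗ-congʳ (ℚ.*-zeroˡ (w x))) (*ₗ-zeroˡ (g x)))

  ∑-δ : ∀ n (a : Point n) (g : Point n → Carrierᴹ) → Σᴹ.∑ (points n) (λ x → δ a x *ₗ g x) ≈ᴹ g a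
  ∑-δ zero    []          g = ≈ᴹ-trans (+ᴹ-identityʳ _) (*ₗ-identityˡ _)
  ∑-δ (suc n) (true ∷ a)  g = ≈ᴹ-trans (Σᴹ.∑-points-suc n _)
    (≈ᴹ-trans (+ᴹ-cong (≈ᴹ-trans (∑-1* n (δ a) _) (∑-δ n a (g ∘ (true ∷_))))
                       (∑-0* n (δ a) (g ∘ (false ∷_))))
              (+ᴹ-identityʳ _))
  ∑-δ (suc n) (false ∷ a) g = ≈ᴹ-trans (Σᴹ.∑-points-suc n _)
    (≈ᴹ-trans (+ᴹ-cong (∑-0* n (δ a) (g ∘ (true ∷_)))
                       (≈ᴹ-trans (∑-1* n (δ a) _) (∑-δ n a (g ∘ (false ∷_)))))
              (+ᴹ-identityˡ _))

open ModuleSum (⟨module⟩ {R = ℚring}) using (∑-δ) renaming (*ₗ-∑ to *-∑; ∑-*ₗ to ∑-*)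

-- Characters and the Fourier expansion

∁-involutive : ∀ {n} (x : Subset n) → ∁ (∁ x) ≡ x
∁-involutive []      = refl
∁-involutive (a ∷ x) = cong₂ _∷_ (not-involutive a) (∁-involutive x)

∣p∣+∣∁p∣≡n : ∀ {n} (p : Subset n) → ∣ p ∣ ℕ.+ ∣ ∁ p ∣ ≡ n
∣p∣+∣∁p∣≡n []          = refl
∣p∣+∣∁p∣≡n (true ∷ p)  = cong suc (∣p∣+∣∁p∣≡n p)
∣p∣+∣∁p∣≡n (false ∷ p) = trans (ℕ.+-suc ∣ p ∣ ∣ ∁ p ∣) (cong suc (∣p∣+∣∁p∣≡n p))

∣p∣≡0⇒p≡⊥ : ∀ {n} (p : Subset n) → ∣ p ∣ ≡ 0 → p ≡ ⊥
∣p∣≡0⇒p≡⊥ []          _     = refl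
∣p∣≡0⇒p≡⊥ (false ∷ p) ∣p∣≡0 = cong (false ∷_) (∣p∣≡0⇒p≡⊥ p ∣p∣≡0)

∣p∣≤1⇒⊥⊎⁅⁆ : ∀ {n} (p : Subset n) → ∣ p ∣ ℕ.≤ 1 → p ≡ ⊥ ⊎ Σ (Fin n) (λ i → p ≡ ⁅ i ⁆)
∣p∣≤1⇒⊥⊎⁅⁆ []          _           = inj₁ refl
∣p∣≤1⇒⊥⊎⁅⁆ (true ∷ p)  (ℕ.s≤s ∣p∣≤0) = inj₂ (zero , cong (true ∷_) (∣p∣≡0⇒p≡⊥ p (ℕ.n≤0⇒n≡0 ∣p∣≤0)))
∣p∣≤1⇒⊥⊎⁅⁆ (false ∷ p) ∣p∣≤1         =
  ⊎.map (cong (false ∷_)) (λ (i , p≡⁅i⁆) → suc i , cong (false ∷_) p≡⁅i⁆) (∣p∣≤1⇒⊥⊎⁅⁆ p ∣p∣≤1)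

∣++∣ : ∀ {m n} (u : Subset m) (v : Subset n) → ∣ u ++ v ∣ ≡ ∣ u ∣ ℕ.+ ∣ v ∣
∣++∣ []          v = refl
∣++∣ (true ∷ u)  v = cong suc (∣++∣ u v)
∣++∣ (false ∷ u) v = ∣++∣ u v

δ-refl : ∀ {n} (x : Point n) → δ x x ≡ 1ℚ
δ-refl []          = refl
δ-refl (true ∷ x)  = trans (ℚ.*-identityˡ (δ x x)) (δ-refl x)
δ-refl (false ∷ x) = trans (ℚ.*-identityˡ (δ x x)) (δ-refl x)

δ-++ : ∀ {m n} (x y : Point m) (u v : Point n) → δ (x ++ u) (y ++ v) ≡ δ x y * δ u v
δ-++ []      []      u v = sym (ℚ.*-identityˡ (δ u v))
δ-++ (a ∷ x) (b ∷ y) u v =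
  trans (cong (δᵇ a b *_) (δ-++ x y u v)) (sym (ℚ.*-assoc (δᵇ a b) (δ x y) (δ u v)))

δ≡0⊎≡ : ∀ {n} (x y : Point n) → δ x y ≡ 0ℚ ⊎ x ≡ y
δ≡0⊎≡ []          []          = inj₂ refl
δ≡0⊎≡ (true ∷ x)  (false ∷ y) = inj₁ (ℚ.*-zeroˡ (δ x y))
δ≡0⊎≡ (false ∷ x) (true ∷ y)  = inj₁ (ℚ.*-zeroˡ (δ x y))
δ≡0⊎≡ (true ∷ x)  (true ∷ y)  = ⊎.map (trans (ℚ.*-identityˡ (δ x y))) (cong (true ∷_)) (δ≡0⊎≡ x y)
δ≡0⊎≡ (false ∷ x) (false ∷ y) = ⊎.map (trans (ℚ.*-identityˡ (δ x y))) (cong (false ∷_)) (δ≡0⊎≡ x y)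

signℚ-xor : ∀ a b → signℚ (a xor b) ≡ signℚ a * signℚ b
signℚ-xor true  true  = refl
signℚ-xor true  false = refl
signℚ-xor false true  = refl
signℚ-xor false false = refl

chi-cons : ∀ {n} t (T : Subset n) a x → chi (t ∷ T) (a ∷ x) ≡ signℚ (t ∧ a) * chi T x
chi-cons true  T true  x = trans (cong -_ (sym (ℚ.*-identityˡ (chi T x)))) (ℚ.neg-distribˡ-* 1ℚ (chi T x))
chi-cons true  T false x = sym (ℚ.*-identityˡ (chi T x))
chi-cons false T a     x = sym (ℚ.*-identityˡ (chi T x))

chi-∷-true : ∀ {n} u (U : Subset n) x → chi (u ∷ U) (true ∷ x) ≡ signℚ u * chi U x
chi-∷-true true  U x = chi-cons true U true x
chi-∷-true false U x = chi-cons false U true x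

chi-∷-false : ∀ {n} u (U : Subset n) x → chi (u ∷ U) (false ∷ x) ≡ chi U x
chi-∷-false true  U x = refl
chi-∷-false false U x = refl

chi-++ : ∀ {m n} (T : Subset m) (U : Subset n) x y → chi (T ++ U) (x ++ y) ≡ chi T x * chi U y
chi-++ []      U []      y = sym (ℚ.*-identityˡ (chi U y))
chi-++ (t ∷ T) U (a ∷ x) y = begin
  chi (t ∷ T ++ U) (a ∷ x ++ y)          ≡⟨ chi-cons t (T ++ U) a (x ++ y) ⟩
  signℚ (t ∧ a) * chi (T ++ U) (x ++ y)  ≡⟨ cong (signℚ (t ∧ a) *_) (chi-++ T U x y) ⟩
  signℚ (t ∧ a) * (chi T x * chi U y)    ≡⟨ ℚ.*-assoc (signℚ (t ∧ a)) (chi T x) (chi U y) ⟨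
  signℚ (t ∧ a) * chi T x * chi U y      ≡⟨ cong (_* chi U y) (chi-cons t T a x) ⟨
  chi (t ∷ T) (a ∷ x) * chi U y          ∎
  where open ≡-Reasoning

chi-⊥ : ∀ {n} (x : Point n) → chi ⊥ x ≡ 1ℚ
chi-⊥ []      = refl
chi-⊥ (a ∷ x) = chi-⊥ x

chi-at-⊥ : ∀ {n} (T : Subset n) → chi T ⊥ ≡ 1ℚ
chi-at-⊥ []      = refl
chi-at-⊥ (true ∷ T)  = chi-at-⊥ T
chi-at-⊥ (false ∷ T) = chi-at-⊥ T

chi-∁ : ∀ {n} (T : Subset n) x → chi T (∁ x) ≡ negOnePow ∣ T ∣ * chi T x
chi-∁ []          []          = refl
chi-∁ (false ∷ T) (a ∷ x)     = chi-∁ T x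
chi-∁ (true ∷ T)  (true ∷ x)  = trans (chi-∁ T x) (neg*neg (negOnePow ∣ T ∣) (chi T x))
  where
  neg*neg : ∀ p q → p * q ≡ (- p) * (- q)
  neg*neg = solve-∀ ℚ-ring
chi-∁ (true ∷ T)  (false ∷ x) =
  trans (cong -_ (chi-∁ T x)) (ℚ.neg-distribˡ-* (negOnePow ∣ T ∣) (chi T x))

½[sign*sign+1]≡δᵇ : ∀ a b → ½ * (signℚ a * signℚ b + 1ℚ) ≡ δᵇ a b
½[sign*sign+1]≡δᵇ true  true  = refl
½[sign*sign+1]≡δᵇ true  false = refl
½[sign*sign+1]≡δᵇ false true  = refl
½[sign*sign+1]≡δᵇ false false = refl

orthogonality : ∀ n (x z : Point n) → halfPow n * ∑ (points n) (λ T → chi T x * chi T z) ≡ δ x z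
orthogonality zero    []      []      = refl
orthogonality (suc n) (a ∷ x) (b ∷ z) = begin
  ½ * halfPow n * ∑ (points (suc n)) (λ T → chi T (a ∷ x) * chi T (b ∷ z))
    ≡⟨ cong (½ * halfPow n *_) (∑-points-suc n (λ T → chi T (a ∷ x) * chi T (b ∷ z))) ⟩
  ½ * halfPow n * (∑ (points n) (λ T → chi (true ∷ T) (a ∷ x) * chi (true ∷ T) (b ∷ z)) + K)
    ≡⟨ cong (λ s → ½ * halfPow n * (s + K)) signs-out ⟩
  ½ * halfPow n * (signℚ a * signℚ b * K + K)
    ≡⟨ regroup ½ (halfPow n) (signℚ a * signℚ b) K ⟩
  ½ * (signℚ a * signℚ b + 1ℚ) * (halfPow n * K)
    ≡⟨ cong₂ _*_ (½[sign*sign+1]≡δᵇ a b) (orthogonality n x z) ⟩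
  δᵇ a b * δ x z ∎
  where
  open ≡-Reasoning
  K : ℚ
  K = ∑ (points n) (λ T → chi T x * chi T z)
  interchange : ∀ p q u v → (p * u) * (q * v) ≡ (p * q) * (u * v)
  interchange = solve-∀ ℚ-ring
  regroup : ∀ h p s k → h * p * (s * k + k) ≡ h * (s + 1ℚ) * (p * k)
  regroup = solve-∀ ℚ-ring
  signs-out : ∑ (points n) (λ T → chi (true ∷ T) (a ∷ x) * chi (true ∷ T) (b ∷ z)) ≡
              signℚ a * signℚ b * K
  signs-out = trans
    (∑-cong (points n) (λ T → trans (cong₂ _*_ (chi-cons true T a x) (chi-cons true T b z))
                                    (interchange (signℚ a) (signℚ b) (chi T x) (chi T z))))
    (sym (*-∑ (points n) (signℚ a * signℚ b) (λ T → chi T x * chi T z)))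

moment : ∀ {n} → (Point n → ℚ) → Subset n → ℚ
moment {n} ν T = ∑ (points n) (λ x → ν x * chi T x)

module Expansion {c ℓ : Level} (M : Module ℚring c ℓ) where
  open Module M
  open import Relation.Binary.Reasoning.Setoid ≈ᴹ-setoid
  private
    module Sᴹ = ModuleSum M
    module Σᴹ = Sᴹ.Σᴹ

  private
    *ₗ-*ₗ-∑ : ∀ (xs : List A) p q (g : A → ℚ) (v : A → Carrierᴹ) →
              p *ₗ (q *ₗ Σᴹ.∑ xs (λ x → g x *ₗ v x)) ≈ᴹ Σᴹ.∑ xs (λ x → (p * (q * g x)) *ₗ v x)
    *ₗ-*ₗ-∑ xs p q g v = begin
      p *ₗ (q *ₗ Σᴹ.∑ xs (λ x → g x *ₗ v x))  ≈⟨ *ₗ-congˡ (Sᴹ.*ₗ-∑ xs q _) ⟩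
      p *ₗ Σᴹ.∑ xs (λ x → q *ₗ (g x *ₗ v x))  ≈⟨ Sᴹ.*ₗ-∑ xs p _ ⟩
      Σᴹ.∑ xs (λ x → p *ₗ (q *ₗ (g x *ₗ v x))) ≈⟨ Σᴹ.∑-cong xs (λ x → ≈ᴹ-sym (assoc² (g x) (v x))) ⟩
      Σᴹ.∑ xs (λ x → (p * (q * g x)) *ₗ v x)  ∎
      where
      assoc² : ∀ r u → (p * (q * r)) *ₗ u ≈ᴹ p *ₗ (q *ₗ (r *ₗ u))
      assoc² r u = ≈ᴹ-trans (*ₗ-assoc p _ u) (*ₗ-congˡ (*ₗ-assoc q r u))

  fourier-expansion : ∀ {n} (f : Point n → Carrierᴹ) x →
                      f x ≈ᴹ Σᴹ.∑ (points n) (λ T → chi T x *ₗ fourier M f T)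
  fourier-expansion {n} f x = ≈ᴹ-sym (begin
    Σᴹ.∑ (points n) (λ T → chi T x *ₗ fourier M f T)
      ≈⟨ Σᴹ.∑-cong (points n) (λ T → *ₗ-*ₗ-∑ (points n) (chi T x) (halfPow n) (chi T) f) ⟩
    Σᴹ.∑ (points n) (λ T → Σᴹ.∑ (points n) (λ z → (chi T x * (halfPow n * chi T z)) *ₗ f z))
      ≈⟨ Σᴹ.∑-comm (points n) (points n) _ ⟩
    Σᴹ.∑ (points n) (λ z → Σᴹ.∑ (points n) (λ T → (chi T x * (halfPow n * chi T z)) *ₗ f z))
      ≈⟨ Σᴹ.∑-cong (points n) (λ z → ≈ᴹ-sym (Sᴹ.∑-*ₗ (points n) _ (f z))) ⟩
    Σᴹ.∑ (points n) (λ z → ∑ (points n) (λ T → chi T x * (halfPow n * chi T z)) *ₗ f z)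
      ≈⟨ Σᴹ.∑-cong (points n) (λ z → *ₗ-congʳ (trans (pull z) (orthogonality n x z))) ⟩
    Σᴹ.∑ (points n) (λ z → δ x z *ₗ f z)
      ≈⟨ Sᴹ.∑-δ n x f ⟩
    f x ∎)
    where
    shuffle : ∀ p h q → p * (h * q) ≡ h * (p * q)
    shuffle = solve-∀ ℚ-ring
    pull : ∀ z → ∑ (points n) (λ T → chi T x * (halfPow n * chi T z)) ≡
                 halfPow n * ∑ (points n) (λ T → chi T x * chi T z)
    pull z = trans (∑-cong (points n) (λ T → shuffle (chi T x) (halfPow n) (chi T z)))
                   (sym (*-∑ (points n) (halfPow n) _))

  coefficient-as-integral : ∀ {n} d (S : Subset n) (ν : Point n → ℚ) →
    (∀ T → ∣ T ∣ ℕ.≤ d → moment ν T ≡ δ S T) →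
    (f : Point n → Carrierᴹ) → (∀ T → d ℕ.< ∣ T ∣ → fourier M f T ≈ᴹ 0ᴹ) →
    fourier M f S ≈ᴹ Σᴹ.∑ (points n) (λ x → ν x *ₗ f x)
  coefficient-as-integral {n} d S ν moments f high = ≈ᴹ-sym (begin
    Σᴹ.∑ (points n) (λ x → ν x *ₗ f x)
      ≈⟨ Σᴹ.∑-cong (points n) (λ x → *ₗ-congˡ (fourier-expansion f x)) ⟩
    Σᴹ.∑ (points n) (λ x → ν x *ₗ Σᴹ.∑ (points n) (λ T → chi T x *ₗ fourier M f T))
      ≈⟨ Σᴹ.∑-cong (points n) (λ x → ≈ᴹ-trans (Sᴹ.*ₗ-∑ (points n) (ν x) _)
                                  (Σᴹ.∑-cong (points n) (λ T → ≈ᴹ-sym (*ₗ-assoc (ν x) (chi T x) _)))) ⟩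
    Σᴹ.∑ (points n) (λ x → Σᴹ.∑ (points n) (λ T → (ν x * chi T x) *ₗ fourier M f T))
      ≈⟨ Σᴹ.∑-comm (points n) (points n) _ ⟩
    Σᴹ.∑ (points n) (λ T → Σᴹ.∑ (points n) (λ x → (ν x * chi T x) *ₗ fourier M f T))
      ≈⟨ Σᴹ.∑-cong (points n) (λ T → ≈ᴹ-sym (Sᴹ.∑-*ₗ (points n) _ (fourier M f T))) ⟩
    Σᴹ.∑ (points n) (λ T → moment ν T *ₗ fourier M f T)
      ≈⟨ Σᴹ.∑-cong (points n) matching ⟩
    Σᴹ.∑ (points n) (λ T → δ S T *ₗ fourier M f T)
      ≈⟨ Sᴹ.∑-δ n S (fourier M f) ⟩
    fourier M f S ∎)
    where
    matching : ∀ T → moment ν T *ₗ fourier M f T ≈ᴹ δ S T *ₗ fourier M f T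
    matching T with ∣ T ∣ ℕ.≤? d
    ... | yes low = *ₗ-congʳ (moments T low)
    ... | no  big = ≈ᴹ-trans (vanish (moment ν T)) (≈ᴹ-sym (vanish (δ S T)))
      where
      vanish : ∀ r → r *ₗ fourier M f T ≈ᴹ 0ᴹ
      vanish r = ≈ᴹ-trans (*ₗ-congˡ (high T (ℕ.≰⇒> big))) (*ₗ-zeroʳ r)

-- Permuting coordinates

∣swap∣ : ∀ {n} (σ : Swap n) (x : Subset n) → ∣ swap σ x ∣ ≡ ∣ x ∣
∣swap∣ here      (true  ∷ true  ∷ x) = refl
∣swap∣ here      (true  ∷ false ∷ x) = refl
∣swap∣ here      (false ∷ true  ∷ x) = refl
∣swap∣ here      (false ∷ false ∷ x) = refl
∣swap∣ (there σ) (true  ∷ x)         = cong suc (∣swap∣ σ x)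
∣swap∣ (there σ) (false ∷ x)         = ∣swap∣ σ x

swap-∩ : ∀ {n} (σ : Swap n) (T x : Subset n) → swap σ T ∩ swap σ x ≡ swap σ (T ∩ x)
swap-∩ here      (s ∷ t ∷ T) (a ∷ b ∷ x) = refl
swap-∩ (there σ) (t ∷ T)     (a ∷ x)     = cong ((t ∧ a) ∷_) (swap-∩ σ T x)

chi-swap : ∀ {n} (σ : Swap n) (T x : Subset n) → chi (swap σ T) (swap σ x) ≡ chi T x
chi-swap σ T x = cong negOnePow (trans (cong ∣_∣ (swap-∩ σ T x)) (∣swap∣ σ (T ∩ x)))

δ-swap : ∀ {n} (σ : Swap n) (x y : Point n) → δ (swap σ x) (swap σ y) ≡ δ x y
δ-swap here      (a ∷ b ∷ x) (c ∷ e ∷ y) = exchange (δᵇ b e) (δᵇ a c) (δ x y)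
  where
  exchange : ∀ p q r → p * (q * r) ≡ q * (p * r)
  exchange = solve-∀ ℚ-ring
δ-swap (there σ) (a ∷ x)     (b ∷ y)     = cong (δᵇ a b *_) (δ-swap σ x y)

signed : ∀ {n} → (Point n → ℚ) → (Point n → Bool) → Point n → ℚ
signed μ h x = μ x * signℚ (h x)

record Representing {n} (m d : ℕ) (S : Subset n) : Set where
  field
    μ         : Point n → ℚ
    h         : Point n → Bool
    nonneg    : ∀ x → 0ℚ ≤ μ x
    supported : ∀ x → ¬ InW m x → μ x ≡ 0ℚ
    mass      : ∑ (points n) μ ≡ 1ℚ
    moments   : ∀ T → ∣ T ∣ ℕ.≤ d → moment (signed μ h) T ≡ δ S T

representing-swap : ∀ {n m d} {S : Subset n} (σ : Swap n) → Representing m d S → Representing m d (swap σ S)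
representing-swap {n} {m} {d} {S} σ R = record
  { μ         = μ ∘ swap σ
  ; h         = h ∘ swap σ
  ; nonneg    = nonneg ∘ swap σ
  ; supported = λ x x∉W → supported (swap σ x) (x∉W ∘ subst (m ∣_) (∣swap∣ σ x))
  ; mass      = trans (∑-points-swap n σ μ) mass
  ; moments   = moments′
  }
  where
  open Representing R
  open ≡-Reasoning
  moments′ : ∀ T → ∣ T ∣ ℕ.≤ d → moment (signed μ h ∘ swap σ) T ≡ δ (swap σ S) T
  moments′ T |T|≤d = begin
    moment (signed μ h ∘ swap σ) T
      ≡⟨ ∑-cong (points n) (λ x → cong (signed μ h (swap σ x) *_) (chi-swap σ T x)) ⟨
    ∑ (points n) ((λ y → signed μ h y * chi (swap σ T) y) ∘ swap σ)
      ≡⟨ ∑-points-swap n σ (λ y → signed μ h y * chi (swap σ T) y) ⟩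
    moment (signed μ h) (swap σ T)
      ≡⟨ moments (swap σ T) (subst (ℕ._≤ d) (sym (∣swap∣ σ T)) |T|≤d) ⟩
    δ S (swap σ T)
      ≡⟨ δ-swap σ S (swap σ T) ⟨
    δ (swap σ S) (swap σ (swap σ T))
      ≡⟨ cong (δ (swap σ S)) (swap-involutive σ T) ⟩
    δ (swap σ S) T ∎

SwapStep : ∀ {n} → Subset n → Subset n → Set
SwapStep {n} A B = Σ (Swap n) λ σ → swap σ A ≡ B

_↝_ : ∀ {n} → Subset n → Subset n → Set
_↝_ = Star SwapStep

↝-cons : ∀ {n} a {A B : Subset n} → A ↝ B → (a ∷ A) ↝ (a ∷ B)
↝-cons a = Star.gmap (a ∷_) (λ (σ , e) → there σ , cong (a ∷_) e)

↝-sym : ∀ {n} {A B : Subset n} → A ↝ B → B ↝ A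
↝-sym = Star.reverse (λ {A} (σ , e) → σ , trans (cong (swap σ) (sym e)) (swap-involutive σ A))

prefix : ℕ → ∀ n → Subset n
prefix zero    n       = ⊥
prefix (suc k) zero    = []
prefix (suc k) (suc n) = true ∷ prefix k n

∣prefix∣ : ∀ {k n} → k ℕ.≤ n → ∣ prefix k n ∣ ≡ k
∣prefix∣ {zero}  {n}     _           = ∣⊥∣≡0 n
∣prefix∣ {suc k} {suc n} (ℕ.s≤s k≤n) = cong suc (∣prefix∣ k≤n)

↝-bubble : ∀ {k n} → k ℕ.≤ n → (false ∷ prefix k n) ↝ prefix k (suc n)
↝-bubble {zero}  _           = Star.ε
↝-bubble {suc k} (ℕ.s≤s k≤n) = (here , refl) ◅ ↝-cons true (↝-bubble k≤n)

↝-prefix : ∀ {n} (A : Subset n) → A ↝ prefix ∣ A ∣ n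
↝-prefix []          = Star.ε
↝-prefix (true ∷ A)  = ↝-cons true (↝-prefix A)
↝-prefix (false ∷ A) = ↝-cons false (↝-prefix A) ◅◅ ↝-bubble (∣p∣≤n A)

↝-of-equal-size : ∀ {n} (A B : Subset n) → ∣ A ∣ ≡ ∣ B ∣ → A ↝ B
↝-of-equal-size {n} A B |A|≡|B| =
  ↝-prefix A ◅◅ subst (λ k → prefix k n ↝ B) (sym |A|≡|B|) (↝-sym (↝-prefix B))

representing-↝ : ∀ {n m d} {A B : Subset n} → A ↝ B → Representing m d A → Representing m d B
representing-↝ Star.ε             R = R
representing-↝ ((σ , refl) ◅ A↝B) R = representing-↝ A↝B (representing-swap σ R)

-- Measures on concatenated cubes

take-++ : ∀ {m n} (u : Vec A m) (v : Vec A n) → take m (u ++ v) ≡ u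
take-++ {m = m} u v = ++-injectiveˡ (take m (u ++ v)) u (take++drop≡id m (u ++ v))

drop-++ : ∀ {m n} (u : Vec A m) (v : Vec A n) → drop m (u ++ v) ≡ v
drop-++ {m = m} u v = ++-injectiveʳ (take m (u ++ v)) u (take++drop≡id m (u ++ v))

uncurry++ : ∀ {m n} → (Point m → Point n → A) → Point (m ℕ.+ n) → A
uncurry++ {m = m} f x = f (take m x) (drop m x)

uncurry++-++ : ∀ {m n} (f : Point m → Point n → A) u v → uncurry++ f (u ++ v) ≡ f u v
uncurry++-++ f u v = cong₂ f (take-++ u v) (drop-++ u v)

_⊗_ : ∀ {m n} → (Point m → ℚ) → (Point n → ℚ) → Point (m ℕ.+ n) → ℚ
α ⊗ β = uncurry++ (λ u v → α u * β v)

∑-++-factor : ∀ {m n} (g : Point (m ℕ.+ n) → ℚ) (α : Point m → ℚ) (β : Point m → Point n → ℚ) →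
  (∀ u v → g (u ++ v) ≡ α u * β u v) →
  ∑ (points (m ℕ.+ n)) g ≡ ∑ (points m) (λ u → α u * ∑ (points n) (β u))
∑-++-factor {m} {n} g α β split = trans (∑-points-++ m n g)
  (∑-cong (points m) (λ u → trans (∑-cong (points n) (split u)) (sym (*-∑ (points n) (α u) (β u)))))

moment-++ : ∀ {m n} (ν : Point (m ℕ.+ n) → ℚ) (α : Point m → ℚ) (β : Point m → Point n → ℚ) →
  (∀ u v → ν (u ++ v) ≡ α u * β u v) →
  ∀ U V → moment ν (U ++ V) ≡ ∑ (points m) (λ u → (α u * chi U u) * moment (β u) V)
moment-++ ν α β split U V =
  ∑-++-factor (λ x → ν x * chi (U ++ V) x) (λ u → α u * chi U u) (λ u v → β u v * chi V v)
    (λ u v → trans (cong₂ _*_ (split u v) (chi-++ U V u v)) (interchange (α u) (β u v) (chi U u) (chi V v)))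
  where
  interchange : ∀ p q r s → (p * q) * (r * s) ≡ (p * r) * (q * s)
  interchange = solve-∀ ℚ-ring

moment-⊗ : ∀ {m n} (α : Point m → ℚ) (β : Point n → ℚ) U V →
           moment (α ⊗ β) (U ++ V) ≡ moment α U * moment β V
moment-⊗ {m} α β U V = trans (moment-++ (α ⊗ β) α (λ _ → β) (uncurry++-++ _) U V)
  (sym (∑-* (points m) (λ u → α u * chi U u) (moment β V)))

moment-+ : ∀ {n} (f g : Point n → ℚ) T → moment (λ x → f x + g x) T ≡ moment f T + moment g T
moment-+ {n} f g T = trans (∑-cong (points n) (λ x → ℚ.*-distribʳ-+ (chi T x) (f x) (g x)))
  (∑-distrib (points n) (λ x → f x * chi T x) (λ x → g x * chi T x))

moment-δ : ∀ {n} (a : Point n) T → moment (δ a) T ≡ chi T a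
moment-δ {n} a T = ∑-δ n a (chi T)

mass≡moment-⊥ : ∀ {n} (μ : Point n → ℚ) → ∑ (points n) μ ≡ moment μ ⊥
mass≡moment-⊥ {n} μ =
  ∑-cong (points n) (λ x → trans (sym (ℚ.*-identityʳ (μ x))) (cong (μ x *_) (sym (chi-⊥ x))))

∑-pair-∁ : ∀ n (g : Point (suc n) → ℚ) →
           ∑ (points (suc n)) g ≡ ∑ (points n) (λ e → g (false ∷ e) + g (true ∷ ∁ e))
∑-pair-∁ n g = begin
  ∑ (points (suc n)) g                  ≡⟨ ∑-points-suc n g ⟩
  ∑ (points n) g₁ + ∑ (points n) g₀     ≡⟨ ℚ.+-comm (∑ (points n) g₁) _ ⟩
  ∑ (points n) g₀ + ∑ (points n) g₁     ≡⟨ cong (∑ (points n) g₀ +_) (∑-points-∁ n g₁) ⟨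
  ∑ (points n) g₀ + ∑ (points n) (g₁ ∘ ∁) ≡⟨ ∑-distrib (points n) g₀ (g₁ ∘ ∁) ⟨
  ∑ (points n) (λ e → g₀ e + g₁ (∁ e))  ∎
  where
  open ≡-Reasoning
  g₀ g₁ : Point n → ℚ
  g₀ = g ∘ (false ∷_)
  g₁ = g ∘ (true ∷_)

-- Pairs and blocks

*-zeroˡ-≡ : ∀ {p} q → p ≡ 0ℚ → p * q ≡ 0ℚ
*-zeroˡ-≡ q refl = ℚ.*-zeroˡ q

*-zeroʳ-≡ : ∀ p {q} → q ≡ 0ℚ → p * q ≡ 0ℚ
*-zeroʳ-≡ p refl = ℚ.*-zeroʳ p

0≤+ : ∀ {p q} → 0ℚ ≤ p → 0ℚ ≤ q → 0ℚ ≤ p + q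
0≤+ = ℚ.+-mono-≤

0≤* : ∀ {p q} → 0ℚ ≤ p → 0ℚ ≤ q → 0ℚ ≤ p * q
0≤* {p} {q} 0≤p 0≤q = ℚ.nonNegative⁻¹ (p * q)
  {{ℚ.nonNeg*nonNeg⇒nonNeg p {{nonNegative 0≤p}} q {{nonNegative 0≤q}}}}

0≤1 : 0ℚ ≤ 1ℚ
0≤1 = ℚ.nonNegative⁻¹ 1ℚ

0≤½ : 0ℚ ≤ ½
0≤½ = ℚ.nonNegative⁻¹ ½

0≤δ : ∀ {n} (x y : Point n) → 0ℚ ≤ δ x y
0≤δ x y with δ≡0⊎≡ x y
... | inj₁ δ≡0 = ℚ.≤-reflexive (sym δ≡0)
... | inj₂ refl = subst (0ℚ ≤_) (sym (δ-refl x)) 0≤1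

ℕ→ℚ : ℕ → ℚ
ℕ→ℚ zero    = 0ℚ
ℕ→ℚ (suc n) = 1ℚ + ℕ→ℚ n

0≤ℕ→ℚ : ∀ n → 0ℚ ≤ ℕ→ℚ n
0≤ℕ→ℚ zero    = ℚ.≤-refl
0≤ℕ→ℚ (suc n) = 0≤+ 0≤1 (0≤ℕ→ℚ n)

ℕ→ℚ-suc-positive : ∀ n → Positive (ℕ→ℚ (suc n))
ℕ→ℚ-suc-positive n = ℚ.pos+nonNeg⇒pos 1ℚ (ℕ→ℚ n) {{nonNegative (0≤ℕ→ℚ n)}}

1/ℕ→ℚ-suc : ℕ → ℚ
1/ℕ→ℚ-suc n = (1/ ℕ→ℚ (suc n)) {{ℚ.pos⇒nonZero (ℕ→ℚ (suc n)) {{ℕ→ℚ-suc-positive n}}}}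

1/ℕ→ℚ-suc-inverse : ∀ n → 1/ℕ→ℚ-suc n * ℕ→ℚ (suc n) ≡ 1ℚ
1/ℕ→ℚ-suc-inverse n =
  ℚ.*-inverseˡ (ℕ→ℚ (suc n)) {{ℚ.pos⇒nonZero (ℕ→ℚ (suc n)) {{ℕ→ℚ-suc-positive n}}}}

0≤1/ℕ→ℚ-suc : ∀ n → 0ℚ ≤ 1/ℕ→ℚ-suc n
0≤1/ℕ→ℚ-suc n = ℚ.nonNegative⁻¹ (1/ℕ→ℚ-suc n)
  {{ℚ.pos⇒nonNeg (1/ℕ→ℚ-suc n) {{ℚ.1/pos⇒pos (ℕ→ℚ (suc n)) {{ℕ→ℚ-suc-positive n}}}}}}

double : ℕ → ℕ
double zero    = zero
double (suc q) = suc (suc (double q))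

double≡+ : ∀ q → double q ≡ q ℕ.+ q
double≡+ zero    = refl
double≡+ (suc q) = cong suc (trans (cong suc (double≡+ q)) (sym (ℕ.+-suc q q)))

oneHot : Point 2 → ℚ
oneHot (true  ∷ true  ∷ []) = 0ℚ
oneHot (true  ∷ false ∷ []) = ½
oneHot (false ∷ true  ∷ []) = ½
oneHot (false ∷ false ∷ []) = 0ℚ

-- A point of Point (double q) is read as q consecutive pairs. onePerPair is uniform over the points
-- with exactly one -1 in every pair; onePairFull sums, over the pairs, the measure with -1 on both
-- coordinates of that pair and one -1 in every other pair.
onePerPair : ∀ q → Point (double q) → ℚ
onePerPair zero    = λ _ → 1ℚ
onePerPair (suc q) = oneHot ⊗ onePerPair q

onePairFull : ∀ q → Point (double q) → ℚ
onePairFull zero    = λ _ → 0ℚ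
onePairFull (suc q) = λ x → (δ (true ∷ true ∷ []) ⊗ onePerPair q) x + (oneHot ⊗ onePairFull q) x

onePerPair-⊥ : ∀ q → moment (onePerPair q) ⊥ ≡ 1ℚ
onePerPair-⊥ zero    = refl
onePerPair-⊥ (suc q) = trans (moment-⊗ oneHot (onePerPair q) (false ∷ false ∷ []) ⊥)
  (cong (moment oneHot (false ∷ false ∷ []) *_) (onePerPair-⊥ q))

onePerPair-⁅⁆ : ∀ q (i : Fin (double q)) → moment (onePerPair q) ⁅ i ⁆ ≡ 0ℚ
onePerPair-⁅⁆ (suc q) zero = trans (moment-⊗ oneHot (onePerPair q) (true ∷ false ∷ []) ⊥)
  (cong (moment oneHot (true ∷ false ∷ []) *_) (onePerPair-⊥ q))
onePerPair-⁅⁆ (suc q) (suc zero) = trans (moment-⊗ oneHot (onePerPair q) (false ∷ true ∷ []) ⊥)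
  (cong (moment oneHot (false ∷ true ∷ []) *_) (onePerPair-⊥ q))
onePerPair-⁅⁆ (suc q) (suc (suc i)) = trans (moment-⊗ oneHot (onePerPair q) (false ∷ false ∷ []) ⁅ i ⁆)
  (cong (moment oneHot (false ∷ false ∷ []) *_) (onePerPair-⁅⁆ q i))

onePairFull-∷∷ : ∀ q (U₂ : Subset 2) U → moment (onePairFull (suc q)) (U₂ ++ U) ≡
  moment (δ (true ∷ true ∷ [])) U₂ * moment (onePerPair q) U + moment oneHot U₂ * moment (onePairFull q) U
onePairFull-∷∷ q U₂ U =
  trans (moment-+ (δ (true ∷ true ∷ []) ⊗ onePerPair q) (oneHot ⊗ onePairFull q) (U₂ ++ U))
        (cong₂ _+_ (moment-⊗ (δ (true ∷ true ∷ [])) (onePerPair q) U₂ U) (moment-⊗ oneHot (onePairFull q) U₂ U))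

onePairFull-⊥ : ∀ q → moment (onePairFull q) ⊥ ≡ ℕ→ℚ q
onePairFull-⊥ zero    = refl
onePairFull-⊥ (suc q) = begin
  moment (onePairFull (suc q)) ((false ∷ false ∷ []) ++ ⊥)
    ≡⟨ onePairFull-∷∷ q (false ∷ false ∷ []) ⊥ ⟩
  1ℚ * moment (onePerPair q) ⊥ + 1ℚ * moment (onePairFull q) ⊥
    ≡⟨ cong₂ (λ a b → 1ℚ * a + 1ℚ * b) (onePerPair-⊥ q) (onePairFull-⊥ q) ⟩
  1ℚ * 1ℚ + 1ℚ * ℕ→ℚ q
    ≡⟨ cong (1ℚ +_) (ℚ.*-identityˡ (ℕ→ℚ q)) ⟩
  ℕ→ℚ (suc q) ∎
  where open ≡-Reasoning

onePairFull-in-first-pair : ∀ q U₂ → moment (δ (true ∷ true ∷ [])) U₂ ≡ - 1ℚ → moment oneHot U₂ ≡ 0ℚ →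
  moment (onePairFull (suc q)) (U₂ ++ ⊥) ≡ - 1ℚ
onePairFull-in-first-pair q U₂ δ≡-1 oneHot≡0 = begin
  moment (onePairFull (suc q)) (U₂ ++ ⊥)
    ≡⟨ onePairFull-∷∷ q U₂ ⊥ ⟩
  moment (δ (true ∷ true ∷ [])) U₂ * moment (onePerPair q) ⊥ + moment oneHot U₂ * moment (onePairFull q) ⊥
    ≡⟨ cong₂ (λ a b → a * moment (onePerPair q) ⊥ + b * moment (onePairFull q) ⊥) δ≡-1 oneHot≡0 ⟩
  - 1ℚ * moment (onePerPair q) ⊥ + 0ℚ * moment (onePairFull q) ⊥
    ≡⟨ cong₂ (λ a b → - 1ℚ * a + b) (onePerPair-⊥ q) (ℚ.*-zeroˡ (moment (onePairFull q) ⊥)) ⟩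
  - 1ℚ * 1ℚ + 0ℚ ∎
  where open ≡-Reasoning

onePairFull-⁅⁆ : ∀ q (i : Fin (double q)) → moment (onePairFull q) ⁅ i ⁆ ≡ - 1ℚ
onePairFull-⁅⁆ (suc q) zero          = onePairFull-in-first-pair q (true ∷ false ∷ []) refl refl
onePairFull-⁅⁆ (suc q) (suc zero)    = onePairFull-in-first-pair q (false ∷ true ∷ []) refl refl
onePairFull-⁅⁆ (suc q) (suc (suc i)) = trans (onePairFull-∷∷ q (false ∷ false ∷ []) ⁅ i ⁆)
  (cong₂ (λ a b → 1ℚ * a + 1ℚ * b) (onePerPair-⁅⁆ q i) (onePairFull-⁅⁆ q i))

0≤oneHot : ∀ u → 0ℚ ≤ oneHot u
0≤oneHot (true  ∷ true  ∷ []) = ℚ.≤-refl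
0≤oneHot (true  ∷ false ∷ []) = 0≤½
0≤oneHot (false ∷ true  ∷ []) = 0≤½
0≤oneHot (false ∷ false ∷ []) = ℚ.≤-refl

0≤onePerPair : ∀ q p → 0ℚ ≤ onePerPair q p
0≤onePerPair zero    p           = 0≤1
0≤onePerPair (suc q) (a ∷ b ∷ p) = 0≤* (0≤oneHot (a ∷ b ∷ [])) (0≤onePerPair q p)

0≤onePairFull : ∀ q p → 0ℚ ≤ onePairFull q p
0≤onePairFull zero    p           = ℚ.≤-refl
0≤onePairFull (suc q) (a ∷ b ∷ p) =
  0≤+ (0≤* (0≤δ (true ∷ true ∷ []) (a ∷ b ∷ [])) (0≤onePerPair q p))
      (0≤* (0≤oneHot (a ∷ b ∷ [])) (0≤onePairFull q p))

onePerPair-support : ∀ q p → onePerPair q p ≡ 0ℚ ⊎ ∣ p ∣ ≡ q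
onePerPair-support zero    []                  = inj₂ refl
onePerPair-support (suc q) (true  ∷ true  ∷ p) = inj₁ (ℚ.*-zeroˡ (onePerPair q p))
onePerPair-support (suc q) (true  ∷ false ∷ p) = ⊎.map (*-zeroʳ-≡ ½) (cong suc) (onePerPair-support q p)
onePerPair-support (suc q) (false ∷ true  ∷ p) = ⊎.map (*-zeroʳ-≡ ½) (cong suc) (onePerPair-support q p)
onePerPair-support (suc q) (false ∷ false ∷ p) = inj₁ (ℚ.*-zeroˡ (onePerPair q p))

onePairFull-support : ∀ q p → onePairFull q p ≡ 0ℚ ⊎ ∣ p ∣ ≡ suc q
onePairFull-support zero    []                  = inj₁ refl
onePairFull-support (suc q) (true  ∷ true  ∷ p) =
  ⊎.map (λ P₁≡0 → cong₂ _+_ (*-zeroʳ-≡ 1ℚ P₁≡0) (ℚ.*-zeroˡ (onePairFull q p))) (cong (ℕ.suc ∘ ℕ.suc))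
        (onePerPair-support q p)
onePairFull-support (suc q) (true  ∷ false ∷ p) =
  ⊎.map (λ P₂≡0 → cong₂ _+_ (ℚ.*-zeroˡ (onePerPair q p)) (*-zeroʳ-≡ ½ P₂≡0)) (cong suc) (onePairFull-support q p)
onePairFull-support (suc q) (false ∷ true  ∷ p) =
  ⊎.map (λ P₂≡0 → cong₂ _+_ (ℚ.*-zeroˡ (onePerPair q p)) (*-zeroʳ-≡ ½ P₂≡0)) (cong suc) (onePairFull-support q p)
onePairFull-support (suc q) (false ∷ false ∷ p) =
  inj₁ (cong₂ _+_ (ℚ.*-zeroˡ (onePerPair q p)) (ℚ.*-zeroˡ (onePairFull q p)))

module Block (q : ℕ) where

  K : ℕ
  K = suc q

  w : ℚ
  w = ½ * 1/ℕ→ℚ-suc q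

  w-normalises : w * ℕ→ℚ K ≡ ½
  w-normalises = trans (ℚ.*-assoc ½ (1/ℕ→ℚ-suc q) (ℕ→ℚ K))
    (trans (cong (½ *_) (1/ℕ→ℚ-suc-inverse q)) (ℚ.*-identityʳ ½))

  -- Given x₀ = -1, ρ is onePerPair; given x₀ = 1 it mixes the origin (moments +1) with onePairFull
  -- (mass q, moments -1), and w = 1/(2K) gives this half mass ½.
  ρ : Point (suc (double q)) → ℚ
  ρ (true  ∷ p) = ½ * onePerPair q p
  ρ (false ∷ p) = w * (δ ⊥ p + onePairFull q p)

  ρ-moment : ∀ u U → moment ρ (u ∷ U) ≡
                     ½ * signℚ u * moment (onePerPair q) U + w * (1ℚ + moment (onePairFull q) U)
  ρ-moment u U =
    trans (∑-points-suc (double q) (λ e → ρ e * chi (u ∷ U) e)) (cong₂ _+_ true-half false-half)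
    where
    open ≡-Reasoning
    N : ℕ
    N = double q
    regroup : ∀ h p s c → (h * p) * (s * c) ≡ (h * s) * (p * c)
    regroup = solve-∀ ℚ-ring
    true-half : ∑ (points N) (λ p → ρ (true ∷ p) * chi (u ∷ U) (true ∷ p)) ≡
                 ½ * signℚ u * moment (onePerPair q) U
    true-half = begin
      ∑ (points N) (λ p → ½ * onePerPair q p * chi (u ∷ U) (true ∷ p))
        ≡⟨ ∑-cong (points N) (λ p → trans (cong (½ * onePerPair q p *_) (chi-∷-true u U p))
                                          (regroup ½ (onePerPair q p) (signℚ u) (chi U p))) ⟩
      ∑ (points N) (λ p → ½ * signℚ u * (onePerPair q p * chi U p))
        ≡⟨ *-∑ (points N) (½ * signℚ u) _ ⟨
      ½ * signℚ u * moment (onePerPair q) U ∎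
    false-half : ∑ (points N) (λ p → ρ (false ∷ p) * chi (u ∷ U) (false ∷ p)) ≡
                  w * (1ℚ + moment (onePairFull q) U)
    false-half = begin
      ∑ (points N) (λ p → w * (δ ⊥ p + onePairFull q p) * chi (u ∷ U) (false ∷ p))
        ≡⟨ ∑-cong (points N) (λ p → trans (cong (w * (δ ⊥ p + onePairFull q p) *_) (chi-∷-false u U p))
                                          (ℚ.*-assoc w _ (chi U p))) ⟩
      ∑ (points N) (λ p → w * ((δ ⊥ p + onePairFull q p) * chi U p))
        ≡⟨ *-∑ (points N) w _ ⟨
      w * moment (λ p → δ ⊥ p + onePairFull q p) U
        ≡⟨ cong (w *_) (moment-+ (δ ⊥) (onePairFull q) U) ⟩
      w * (moment (δ ⊥) U + moment (onePairFull q) U)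
        ≡⟨ cong (λ a → w * (a + moment (onePairFull q) U)) (trans (moment-δ ⊥ U) (chi-at-⊥ U)) ⟩
      w * (1ℚ + moment (onePairFull q) U) ∎

  ρ-moment-⊥ : moment ρ ⊥ ≡ 1ℚ
  ρ-moment-⊥ = begin
    moment ρ (false ∷ ⊥)
      ≡⟨ ρ-moment false ⊥ ⟩
    ½ * 1ℚ * moment (onePerPair q) ⊥ + w * (1ℚ + moment (onePairFull q) ⊥)
      ≡⟨ cong₂ (λ a b → ½ * 1ℚ * a + w * (1ℚ + b)) (onePerPair-⊥ q) (onePairFull-⊥ q) ⟩
    ½ * 1ℚ * 1ℚ + w * ℕ→ℚ K
      ≡⟨ cong (½ * 1ℚ * 1ℚ +_) w-normalises ⟩
    1ℚ ∎
    where open ≡-Reasoning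

  ρ-moment-⁅⁆ : ∀ i → moment ρ ⁅ i ⁆ ≡ 0ℚ
  ρ-moment-⁅⁆ zero = begin
    moment ρ (true ∷ ⊥)
      ≡⟨ ρ-moment true ⊥ ⟩
    ½ * - 1ℚ * moment (onePerPair q) ⊥ + w * (1ℚ + moment (onePairFull q) ⊥)
      ≡⟨ cong₂ (λ a b → ½ * - 1ℚ * a + w * (1ℚ + b)) (onePerPair-⊥ q) (onePairFull-⊥ q) ⟩
    ½ * - 1ℚ * 1ℚ + w * ℕ→ℚ K
      ≡⟨ cong (½ * - 1ℚ * 1ℚ +_) w-normalises ⟩
    0ℚ ∎
    where open ≡-Reasoning
  ρ-moment-⁅⁆ (suc i) = begin
    moment ρ (false ∷ ⁅ i ⁆)
      ≡⟨ ρ-moment false ⁅ i ⁆ ⟩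
    ½ * 1ℚ * moment (onePerPair q) ⁅ i ⁆ + w * (1ℚ + moment (onePairFull q) ⁅ i ⁆)
      ≡⟨ cong₂ (λ a b → ½ * 1ℚ * a + w * (1ℚ + b)) (onePerPair-⁅⁆ q i) (onePairFull-⁅⁆ q i) ⟩
    ½ * 1ℚ * 0ℚ + w * 0ℚ
      ≡⟨ cong (½ * 1ℚ * 0ℚ +_) (ℚ.*-zeroʳ w) ⟩
    0ℚ ∎
    where open ≡-Reasoning

  0≤ρ : ∀ e → 0ℚ ≤ ρ e
  0≤ρ (true  ∷ p) = 0≤* 0≤½ (0≤onePerPair q p)
  0≤ρ (false ∷ p) = 0≤* (0≤* 0≤½ (0≤1/ℕ→ℚ-suc q)) (0≤+ (0≤δ ⊥ p) (0≤onePairFull q p))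

  ρ-support : ∀ e → ρ e ≡ 0ℚ ⊎ (∣ e ∣ ≡ 0 ⊎ ∣ e ∣ ≡ K)
  ρ-support (true ∷ p) = ⊎.map (*-zeroʳ-≡ ½) (inj₂ ∘ cong ℕ.suc) (onePerPair-support q p)
  ρ-support (false ∷ p) with δ≡0⊎≡ ⊥ p
  ... | inj₂ refl = inj₂ (inj₁ (∣⊥∣≡0 (double q)))
  ... | inj₁ δ≡0  = ⊎.map (λ P₂≡0 → *-zeroʳ-≡ w (cong₂ _+_ δ≡0 P₂≡0)) inj₂ (onePairFull-support q p)

  m : ℕ
  m = double K

  core : Point m → Point (suc (double q))
  core (false ∷ c) = c
  core (true  ∷ c) = ∁ c

  μᵇ : Point m → ℚ
  μᵇ b = ½ * ρ (core b)

  hᵇ : Point m → Bool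
  hᵇ (s ∷ _) = s

  -- Whether the block's weight is K rather than 0 or m (block-support).
  class : Point m → Bool
  class b = 0 ℕ.<ᵇ ∣ core b ∣

  νᵇ : Point m → ℚ
  νᵇ = signed μᵇ hᵇ

  block-mass : ∑ (points m) μᵇ ≡ 1ℚ
  block-mass = begin
    ∑ (points m) μᵇ
      ≡⟨ ∑-pair-∁ (suc (double q)) μᵇ ⟩
    ∑ (points (suc (double q))) (λ e → ½ * ρ e + ½ * ρ (∁ (∁ e)))
      ≡⟨ ∑-cong (points (suc (double q)))
                (λ e → trans (cong (λ c → ½ * ρ e + ½ * ρ c) (∁-involutive e)) (halves (ρ e))) ⟩
    ∑ (points (suc (double q))) ρ
      ≡⟨ mass≡moment-⊥ ρ ⟩
    moment ρ ⊥
      ≡⟨ ρ-moment-⊥ ⟩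
    1ℚ ∎
    where
    open ≡-Reasoning
    halves : ∀ p → ½ * p + ½ * p ≡ p
    halves = solve-∀ ℚ-ring

  block-moment : ∀ u U → moment νᵇ (u ∷ U) ≡ ½ * (1ℚ - signℚ u * negOnePow ∣ U ∣) * moment ρ U
  block-moment u U = begin
    moment νᵇ (u ∷ U)
      ≡⟨ ∑-pair-∁ (suc (double q)) (λ b → νᵇ b * chi (u ∷ U) b) ⟩
    ∑ (points (suc (double q)))
      (λ e → νᵇ (false ∷ e) * chi (u ∷ U) (false ∷ e) + νᵇ (true ∷ ∁ e) * chi (u ∷ U) (true ∷ ∁ e))
      ≡⟨ ∑-cong (points (suc (double q))) pointwise ⟩
    ∑ (points (suc (double q))) (λ e → ½ * (1ℚ - signℚ u * negOnePow ∣ U ∣) * (ρ e * chi U e))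
      ≡⟨ *-∑ (points (suc (double q))) (½ * (1ℚ - signℚ u * negOnePow ∣ U ∣)) _ ⟨
    ½ * (1ℚ - signℚ u * negOnePow ∣ U ∣) * moment ρ U ∎
    where
    open ≡-Reasoning
    combine : ∀ r c s n → ½ * r * 1ℚ * c + ½ * r * - 1ℚ * (s * (n * c)) ≡ ½ * (1ℚ + - (s * n)) * (r * c)
    combine = solve-∀ ℚ-ring
    pointwise : ∀ e → νᵇ (false ∷ e) * chi (u ∷ U) (false ∷ e) + νᵇ (true ∷ ∁ e) * chi (u ∷ U) (true ∷ ∁ e)
                    ≡ ½ * (1ℚ - signℚ u * negOnePow ∣ U ∣) * (ρ e * chi U e)
    pointwise e = begin
      νᵇ (false ∷ e) * chi (u ∷ U) (false ∷ e) + ½ * ρ (∁ (∁ e)) * - 1ℚ * chi (u ∷ U) (true ∷ ∁ e)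
        ≡⟨ cong₂ (λ c x → νᵇ (false ∷ e) * x + ½ * ρ c * - 1ℚ * chi (u ∷ U) (true ∷ ∁ e))
                 (∁-involutive e) (chi-∷-false u U e) ⟩
      ½ * ρ e * 1ℚ * chi U e + ½ * ρ e * - 1ℚ * chi (u ∷ U) (true ∷ ∁ e)
        ≡⟨ cong (λ x → ½ * ρ e * 1ℚ * chi U e + ½ * ρ e * - 1ℚ * x)
                (trans (chi-∷-true u U (∁ e)) (cong (signℚ u *_) (chi-∁ U e))) ⟩
      ½ * ρ e * 1ℚ * chi U e + ½ * ρ e * - 1ℚ * (signℚ u * (negOnePow ∣ U ∣ * chi U e))
        ≡⟨ combine (ρ e) (chi U e) (signℚ u) (negOnePow ∣ U ∣) ⟩
      ½ * (1ℚ - signℚ u * negOnePow ∣ U ∣) * (ρ e * chi U e) ∎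

  block-moments : ∀ T → ∣ T ∣ ℕ.≤ 1 → moment νᵇ T ≡ δ ⁅ zero ⁆ T
  block-moments T ∣T∣≤1 with ∣p∣≤1⇒⊥⊎⁅⁆ T ∣T∣≤1
  ... | inj₁ refl = begin
    moment νᵇ (false ∷ ⊥ {suc (double q)})
      ≡⟨ block-moment false ⊥ ⟩
    ½ * (1ℚ - 1ℚ * negOnePow ∣ ⊥ {suc (double q)} ∣) * moment ρ ⊥
      ≡⟨ cong (λ k → ½ * (1ℚ - 1ℚ * negOnePow k) * moment ρ ⊥) (∣⊥∣≡0 (suc (double q))) ⟩
    0ℚ * moment ρ ⊥
      ≡⟨ ℚ.*-zeroˡ (moment ρ ⊥) ⟩
    0ℚ
      ≡⟨ ℚ.*-zeroˡ (δ (⊥ {suc (double q)}) ⊥) ⟨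
    δ (⁅_⁆ {m} zero) ⊥ ∎
    where open ≡-Reasoning
  ... | inj₂ (zero , refl) = begin
    moment νᵇ (true ∷ ⊥ {suc (double q)})
      ≡⟨ block-moment true ⊥ ⟩
    ½ * (1ℚ - - 1ℚ * negOnePow ∣ ⊥ {suc (double q)} ∣) * moment ρ ⊥
      ≡⟨ cong₂ (λ k r → ½ * (1ℚ - - 1ℚ * negOnePow k) * r) (∣⊥∣≡0 (suc (double q))) ρ-moment-⊥ ⟩
    1ℚ
      ≡⟨ δ-refl (⁅_⁆ {m} zero) ⟨
    δ (⁅_⁆ {m} zero) ⁅ zero ⁆ ∎
    where open ≡-Reasoning
  ... | inj₂ (suc i , refl) = begin
    moment νᵇ (false ∷ ⁅ i ⁆)
      ≡⟨ block-moment false ⁅ i ⁆ ⟩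
    ½ * (1ℚ - 1ℚ * negOnePow ∣ ⁅ i ⁆ ∣) * moment ρ ⁅ i ⁆
      ≡⟨ *-zeroʳ-≡ (½ * (1ℚ - 1ℚ * negOnePow ∣ ⁅ i ⁆ ∣)) (ρ-moment-⁅⁆ i) ⟩
    0ℚ
      ≡⟨ ℚ.*-zeroˡ (δ ⊥ ⁅ i ⁆) ⟨
    δ (⁅_⁆ {m} zero) ⁅ suc i ⁆ ∎
    where open ≡-Reasoning

  block-balanced : ∀ (G : Bool → ℚ) → ∑ (points m) (λ b → νᵇ b * G (class b)) ≡ 0ℚ
  block-balanced G = trans (∑-pair-∁ (suc (double q)) (λ b → νᵇ b * G (class b)))
    (∑-zero (points (suc (double q))) (λ e →
      trans (cong (λ c → νᵇ (false ∷ e) * G (class (false ∷ e)) + ½ * ρ c * - 1ℚ * G (0 ℕ.<ᵇ ∣ c ∣))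
                  (∁-involutive e))
            (cancel (½ * ρ e) (G (class (false ∷ e))))))
    where
    cancel : ∀ a g → a * 1ℚ * g + a * - 1ℚ * g ≡ 0ℚ
    cancel = solve-∀ ℚ-ring

  0≤μᵇ : ∀ b → 0ℚ ≤ μᵇ b
  0≤μᵇ b = 0≤* 0≤½ (0≤ρ (core b))

  offset : Bool → ℕ
  offset false = 0
  offset true  = K

  offset-xor : ∀ {a c} y t → m ∣ a ℕ.+ offset y → m ∣ c ℕ.+ offset (t xor y) → m ∣ (a ℕ.+ c) ℕ.+ offset t
  offset-xor {a} {c} false false m∣a m∣c = subst (m ∣_) (ℕ-solve a c) (∣m∣n⇒∣m+n m∣a m∣c)
    where
    ℕ-solve : ∀ a c → (a ℕ.+ 0) ℕ.+ (c ℕ.+ 0) ≡ (a ℕ.+ c) ℕ.+ 0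
    ℕ-solve = ℕ-solve-∀
  offset-xor {a} {c} false true  m∣a m∣c = subst (m ∣_) (ℕ-solve a c K) (∣m∣n⇒∣m+n m∣a m∣c)
    where
    ℕ-solve : ∀ a c k → (a ℕ.+ 0) ℕ.+ (c ℕ.+ k) ≡ (a ℕ.+ c) ℕ.+ k
    ℕ-solve = ℕ-solve-∀
  offset-xor {a} {c} true  true  m∣a m∣c = subst (m ∣_) (ℕ-solve a c K) (∣m∣n⇒∣m+n m∣a m∣c)
    where
    ℕ-solve : ∀ a c k → (a ℕ.+ k) ℕ.+ (c ℕ.+ 0) ≡ (a ℕ.+ c) ℕ.+ k
    ℕ-solve = ℕ-solve-∀
  offset-xor {a} {c} true  false m∣a m∣c =
    ∣m+n∣m⇒∣n (subst (m ∣_) (trans (ℕ-solve a c K) (cong (ℕ._+ ((a ℕ.+ c) ℕ.+ 0)) (sym (double≡+ K))))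
                           (∣m∣n⇒∣m+n m∣a m∣c))
              ∣-refl
    where
    ℕ-solve : ∀ a c k → (a ℕ.+ k) ℕ.+ (c ℕ.+ k) ≡ (k ℕ.+ k) ℕ.+ ((a ℕ.+ c) ℕ.+ 0)
    ℕ-solve = ℕ-solve-∀

  offset-class : ∀ k → k ≡ 0 ⊎ k ≡ K → offset (0 ℕ.<ᵇ k) ≡ k
  offset-class _ (inj₁ refl) = refl
  offset-class _ (inj₂ refl) = refl

  block-support : ∀ b → μᵇ b ≡ 0ℚ ⊎ m ∣ ∣ b ∣ ℕ.+ offset (class b)
  block-support (false ∷ c) with ρ-support c
  ... | inj₁ ρ≡0     = inj₁ (*-zeroʳ-≡ ½ ρ≡0)
  ... | inj₂ ∣c∣∈0,K = inj₂ (subst (λ k → m ∣ ∣ c ∣ ℕ.+ k) (sym (offset-class ∣ c ∣ ∣c∣∈0,K)) (doubled ∣c∣∈0,K))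
    where
    doubled : ∣ c ∣ ≡ 0 ⊎ ∣ c ∣ ≡ K → m ∣ ∣ c ∣ ℕ.+ ∣ c ∣
    doubled (inj₁ ∣c∣≡0) rewrite ∣c∣≡0 = m ∣0
    doubled (inj₂ ∣c∣≡K) rewrite ∣c∣≡K = ∣-reflexive (double≡+ K)
  block-support (true ∷ c) with ρ-support (∁ c)
  ... | inj₁ ρ≡0      = inj₁ (*-zeroʳ-≡ ½ ρ≡0)
  ... | inj₂ ∣∁c∣∈0,K = inj₂ (∣-reflexive (sym (begin
    suc ∣ c ∣ ℕ.+ offset (0 ℕ.<ᵇ ∣ ∁ c ∣)  ≡⟨ cong (suc ∣ c ∣ ℕ.+_) (offset-class ∣ ∁ c ∣ ∣∁c∣∈0,K) ⟩
    suc ∣ c ∣ ℕ.+ ∣ ∁ c ∣                  ≡⟨ cong suc (∣p∣+∣∁p∣≡n c) ⟩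
    m                                      ∎)))
    where open ≡-Reasoning

-- Chaining blocks

-- The carry t says which residue, 0 or K mod m, the weight of the remaining coordinates must have;
-- each block shifts it by its own class and the last r ≥ K coordinates realise it.
module Chain (q r : ℕ) where
  open Block q

  length : ℕ → ℕ
  length zero    = r
  length (suc d) = m ℕ.+ length d

  base : Bool → Point r
  base false = ⊥
  base true  = prefix K r

  μᶜ : ∀ d → Bool → Point (length d) → ℚ
  μᶜ zero    t = δ (base t)
  μᶜ (suc d) t = uncurry++ (λ b x → μᵇ b * μᶜ d (t xor class b) x)

  hᶜ : ∀ d → Bool → Point (length d) → Bool
  hᶜ zero    t _ = false
  hᶜ (suc d) t   = uncurry++ (λ b x → hᵇ b xor hᶜ d (t xor class b) x)

  νᶜ : ∀ d → Bool → Point (length d) → ℚ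
  νᶜ d t = signed (μᶜ d t) (hᶜ d t)

  canonical : ∀ d → Subset (length d)
  canonical zero    = ⊥
  canonical (suc d) = ⁅ zero ⁆ ++ canonical d

  ∣canonical∣ : ∀ d → ∣ canonical d ∣ ≡ d
  ∣canonical∣ zero    = ∣⊥∣≡0 r
  ∣canonical∣ (suc d) =
    trans (∣++∣ (⁅_⁆ {m} zero) (canonical d)) (cong₂ ℕ._+_ (∣⁅x⁆∣≡1 {m} zero) (∣canonical∣ d))

  νᶜ-++ : ∀ d t b x → νᶜ (suc d) t (b ++ x) ≡ νᵇ b * νᶜ d (t xor class b) x
  νᶜ-++ d t b x = begin
    μᶜ (suc d) t (b ++ x) * signℚ (hᶜ (suc d) t (b ++ x))
      ≡⟨ cong₂ (λ a s → a * signℚ s) (uncurry++-++ (λ b′ x′ → μᵇ b′ * μᶜ d (t xor class b′) x′) b x)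
                                      (uncurry++-++ (λ b′ x′ → hᵇ b′ xor hᶜ d (t xor class b′) x′) b x) ⟩
    μᵇ b * μᶜ d t′ x * signℚ (hᵇ b xor hᶜ d t′ x)
      ≡⟨ cong (μᵇ b * μᶜ d t′ x *_) (signℚ-xor (hᵇ b) (hᶜ d t′ x)) ⟩
    μᵇ b * μᶜ d t′ x * (signℚ (hᵇ b) * signℚ (hᶜ d t′ x))
      ≡⟨ interchange (μᵇ b) (μᶜ d t′ x) (signℚ (hᵇ b)) (signℚ (hᶜ d t′ x)) ⟩
    νᵇ b * νᶜ d t′ x ∎
    where
    open ≡-Reasoning
    t′ : Bool
    t′ = t xor class b
    interchange : ∀ p q r s → p * q * (r * s) ≡ p * r * (q * s)
    interchange = solve-∀ ℚ-ring

  0≤μᶜ : ∀ d t x → 0ℚ ≤ μᶜ d t x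
  0≤μᶜ zero    t x = 0≤δ (base t) x
  0≤μᶜ (suc d) t x = 0≤* (0≤μᵇ (take m x)) (0≤μᶜ d _ (drop m x))

  chain-mass : ∀ d t → ∑ (points (length d)) (μᶜ d t) ≡ 1ℚ
  chain-mass zero    t = trans (mass≡moment-⊥ (δ (base t))) (trans (moment-δ (base t) ⊥) (chi-⊥ (base t)))
  chain-mass (suc d) t = begin
    ∑ (points (length (suc d))) (μᶜ (suc d) t)
      ≡⟨ ∑-++-factor (μᶜ (suc d) t) μᵇ (λ b → μᶜ d (t xor class b)) (uncurry++-++ _) ⟩
    ∑ (points m) (λ b → μᵇ b * ∑ (points (length d)) (μᶜ d (t xor class b)))
      ≡⟨ ∑-cong (points m) (λ b → trans (cong (μᵇ b *_) (chain-mass d (t xor class b))) (ℚ.*-identityʳ (μᵇ b))) ⟩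
    ∑ (points m) μᵇ
      ≡⟨ block-mass ⟩
    1ℚ ∎
    where open ≡-Reasoning

  chain-support : K ℕ.≤ r → ∀ d t x → μᶜ d t x ≡ 0ℚ ⊎ m ∣ ∣ x ∣ ℕ.+ offset t
  chain-support K≤r zero t x with δ≡0⊎≡ (base t) x
  ... | inj₁ δ≡0 = inj₁ δ≡0
  chain-support K≤r zero false x | inj₂ refl = inj₂ (subst (λ k → m ∣ k ℕ.+ 0) (sym (∣⊥∣≡0 r)) (m ∣0))
  chain-support K≤r zero true  x | inj₂ refl =
    inj₂ (subst (λ k → m ∣ k ℕ.+ K) (sym (∣prefix∣ K≤r)) (∣-reflexive (double≡+ K)))
  chain-support K≤r (suc d) t x
    with block-support (take m x) | chain-support K≤r d (t xor class (take m x)) (drop m x)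
  ... | inj₁ μᵇ≡0 | _         = inj₁ (*-zeroˡ-≡ (μᶜ d (t xor class (take m x)) (drop m x)) μᵇ≡0)
  ... | inj₂ _    | inj₁ μᶜ≡0 = inj₁ (*-zeroʳ-≡ (μᵇ (take m x)) μᶜ≡0)
  ... | inj₂ m∣b  | inj₂ m∣x′ = inj₂ (subst (λ k → m ∣ k ℕ.+ offset t) ∣x∣≡
                                         (offset-xor (class (take m x)) t m∣b m∣x′))
    where
    ∣x∣≡ : ∣ take m x ∣ ℕ.+ ∣ drop m x ∣ ≡ ∣ x ∣
    ∣x∣≡ = trans (sym (∣++∣ (take m x) (drop m x))) (cong ∣_∣ (take++drop≡id m x))

  moment-νᶜ-++ : ∀ d t TB T′ → moment (νᶜ (suc d) t) (TB ++ T′) ≡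
                 ∑ (points m) (λ b → νᵇ b * chi TB b * moment (νᶜ d (t xor class b)) T′)
  moment-νᶜ-++ d t = moment-++ (νᶜ (suc d) t) νᵇ (λ b → νᶜ d (t xor class b)) (νᶜ-++ d t)

  moments-through-block : ∀ d t TB T′ → ∣ TB ∣ ℕ.+ ∣ T′ ∣ ℕ.≤ suc d →
    (∀ t → moment (νᶜ d t) T′ ≡ δ (canonical d) T′) →
    moment (νᶜ (suc d) t) (TB ++ T′) ≡ δ (canonical (suc d)) (TB ++ T′)
  moments-through-block d t TB T′ size moments-T′ = begin
    moment (νᶜ (suc d) t) (TB ++ T′)
      ≡⟨ moment-νᶜ-++ d t TB T′ ⟩
    ∑ (points m) (λ b → νᵇ b * chi TB b * moment (νᶜ d (t xor class b)) T′)
      ≡⟨ ∑-cong (points m) (λ b → cong (νᵇ b * chi TB b *_) (moments-T′ (t xor class b))) ⟩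
    ∑ (points m) (λ b → νᵇ b * chi TB b * δ (canonical d) T′)
      ≡⟨ ∑-* (points m) (λ b → νᵇ b * chi TB b) (δ (canonical d) T′) ⟨
    moment νᵇ TB * δ (canonical d) T′
      ≡⟨ block-factor (δ≡0⊎≡ (canonical d) T′) ⟩
    δ ⁅ zero ⁆ TB * δ (canonical d) T′
      ≡⟨ δ-++ ⁅ zero ⁆ TB (canonical d) T′ ⟨
    δ (canonical (suc d)) (TB ++ T′) ∎
    where
    open ≡-Reasoning
    block-factor : δ (canonical d) T′ ≡ 0ℚ ⊎ canonical d ≡ T′ →
                   moment νᵇ TB * δ (canonical d) T′ ≡ δ ⁅ zero ⁆ TB * δ (canonical d) T′
    block-factor (inj₁ δ≡0)  = trans (*-zeroʳ-≡ (moment νᵇ TB) δ≡0) (sym (*-zeroʳ-≡ (δ ⁅ zero ⁆ TB) δ≡0))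
    block-factor (inj₂ refl) = cong (_* δ (canonical d) (canonical d)) (block-moments TB
      (ℕ.+-cancelʳ-≤ d ∣ TB ∣ 1 (subst (λ k → ∣ TB ∣ ℕ.+ k ℕ.≤ suc d) (∣canonical∣ d) size)))

  moments-past-block : ∀ d t T′ → moment (νᶜ (suc d) t) (⊥ ++ T′) ≡ δ (canonical (suc d)) (⊥ ++ T′)
  moments-past-block d t T′ = begin
    moment (νᶜ (suc d) t) (⊥ ++ T′)
      ≡⟨ moment-νᶜ-++ d t ⊥ T′ ⟩
    ∑ (points m) (λ b → νᵇ b * chi ⊥ b * G (class b))
      ≡⟨ ∑-cong (points m) (λ b → cong (_* G (class b)) (trans (cong (νᵇ b *_) (chi-⊥ b)) (ℚ.*-identityʳ (νᵇ b)))) ⟩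
    ∑ (points m) (λ b → νᵇ b * G (class b))
      ≡⟨ block-balanced G ⟩
    0ℚ
      ≡⟨ ℚ.*-zeroˡ (δ (canonical d) T′) ⟨
    0ℚ * δ (canonical d) T′
      ≡⟨ cong (_* δ (canonical d) T′) (ℚ.*-zeroˡ (δ (⊥ {suc (double q)}) ⊥)) ⟨
    δ (⁅_⁆ {m} zero) ⊥ * δ (canonical d) T′
      ≡⟨ δ-++ (⁅_⁆ {m} zero) ⊥ (canonical d) T′ ⟨
    δ (canonical (suc d)) (⊥ ++ T′) ∎
    where
    open ≡-Reasoning
    G : Bool → ℚ
    G y = moment (νᶜ d (t xor y)) T′

  chain-moments : ∀ d t T → ∣ T ∣ ℕ.≤ d → moment (νᶜ d t) T ≡ δ (canonical d) T
  chain-moments zero t T ∣T∣≤0 rewrite ∣p∣≡0⇒p≡⊥ T (ℕ.n≤0⇒n≡0 ∣T∣≤0) = begin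
    moment (λ x → δ (base t) x * 1ℚ) ⊥
      ≡⟨ ∑-cong (points r) (λ x → cong (_* chi ⊥ x) (ℚ.*-identityʳ (δ (base t) x))) ⟩
    moment (δ (base t)) ⊥  ≡⟨ moment-δ (base t) ⊥ ⟩
    chi ⊥ (base t)         ≡⟨ chi-⊥ (base t) ⟩
    1ℚ                     ≡⟨ δ-refl (⊥ {r}) ⟨
    δ (⊥ {r}) ⊥            ∎
    where open ≡-Reasoning
  chain-moments (suc d) t T ∣T∣≤1+d =
    subst (λ T → moment (νᶜ (suc d) t) T ≡ δ (canonical (suc d)) T) (take++drop≡id m T)
          (split (take m T) (drop m T) (subst (ℕ._≤ suc d) ∣T∣≡ ∣T∣≤1+d))
    where
    ∣T∣≡ : ∣ T ∣ ≡ ∣ take m T ∣ ℕ.+ ∣ drop m T ∣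
    ∣T∣≡ = trans (cong ∣_∣ (sym (take++drop≡id m T))) (∣++∣ (take m T) (drop m T))
    split : ∀ TB T′ → ∣ TB ∣ ℕ.+ ∣ T′ ∣ ℕ.≤ suc d →
            moment (νᶜ (suc d) t) (TB ++ T′) ≡ δ (canonical (suc d)) (TB ++ T′)
    split TB T′ size with ∣ T′ ∣ ℕ.≤? d
    ... | yes ∣T′∣≤d = moments-through-block d t TB T′ size (λ t → chain-moments d t T′ ∣T′∣≤d)
    ... | no  ∣T′∣≰d
      rewrite ∣p∣≡0⇒p≡⊥ TB (ℕ.n≤0⇒n≡0 (ℕ.+-cancelʳ-≤ ∣ T′ ∣ ∣ TB ∣ 0 (ℕ.≤-trans size (ℕ.≰⇒> ∣T′∣≰d))))
      = moments-past-block d t T′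

  chain-representing : K ℕ.≤ r → ∀ d → Representing m d (canonical d)
  chain-representing K≤r d = record
    { μ         = μᶜ d false
    ; h         = hᶜ d false
    ; nonneg    = 0≤μᶜ d false
    ; supported = supported
    ; mass      = chain-mass d false
    ; moments   = chain-moments d false
    }
    where
    supported : ∀ x → ¬ InW m x → μᶜ d false x ≡ 0ℚ
    supported x x∉W with chain-support K≤r d false x
    ... | inj₁ μ≡0 = μ≡0
    ... | inj₂ m∣x = contradiction (subst (m ∣_) (ℕ.+-identityʳ ∣ x ∣) m∣x) x∉W

  length≡ : ∀ d → length d ≡ d ℕ.* m ℕ.+ r
  length≡ zero    = refl
  length≡ (suc d) = trans (cong (m ℕ.+_) (length≡ d)) (sym (ℕ.+-assoc m (d ℕ.* m) r))

even⇒double : ∀ {m} → 2 ℕ.≤ m → 2 ∣ m → Σ ℕ (λ q → m ≡ double (suc q))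
even⇒double 2≤m (divides zero    refl) = contradiction 2≤m (λ ())
even⇒double 2≤m (divides (suc q) refl) = q , trans (ℕ-solve (suc q)) (sym (double≡+ (suc q)))
  where
  ℕ-solve : ∀ k → k ℕ.* 2 ≡ k ℕ.+ k
  ℕ-solve = ℕ-solve-∀

representing-when-length≡ : ∀ q r d → suc q ℕ.≤ r → ∀ n → Chain.length q r d ≡ n →
  (S : Subset n) → ∣ S ∣ ≡ d → Representing (double (suc q)) d S
representing-when-length≡ q r d K≤r .(Chain.length q r d) refl S ∣S∣≡d =
  representing-↝ (↝-of-equal-size (canonical d) S (trans (∣canonical∣ d) (sym ∣S∣≡d)))
                 (chain-representing K≤r d)
  where open Chain q r

representing : ∀ n m d → 2 ℕ.≤ m → 2 ∣ m → 2 ℕ.* m ℕ.* d ℕ.+ m ℕ.≤ 2 ℕ.* n →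
  (S : Subset n) → ∣ S ∣ ≡ d → Representing m d S
representing n m d 2≤m 2∣m size S ∣S∣≡d with even⇒double 2≤m 2∣m
... | q , refl = representing-when-length≡ q r d K≤r n length≡n S ∣S∣≡d
  where
  open ≡-Reasoning
  K r : ℕ
  K = suc q
  r = n ℕ.∸ d ℕ.* double K
  ℕ-solve : ∀ k d → 2 ℕ.* (k ℕ.+ k) ℕ.* d ℕ.+ (k ℕ.+ k) ≡ 2 ℕ.* (d ℕ.* (k ℕ.+ k) ℕ.+ k)
  ℕ-solve = ℕ-solve-∀
  halved : d ℕ.* double K ℕ.+ K ℕ.≤ n
  halved = ℕ.*-cancelˡ-≤ 2 (subst (ℕ._≤ 2 ℕ.* n) (begin
    2 ℕ.* double K ℕ.* d ℕ.+ double K             ≡⟨ cong (λ k → 2 ℕ.* k ℕ.* d ℕ.+ k) (double≡+ K) ⟩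
    2 ℕ.* (K ℕ.+ K) ℕ.* d ℕ.+ (K ℕ.+ K)           ≡⟨ ℕ-solve K d ⟩
    2 ℕ.* (d ℕ.* (K ℕ.+ K) ℕ.+ K)                 ≡⟨ cong (λ k → 2 ℕ.* (d ℕ.* k ℕ.+ K)) (double≡+ K) ⟨
    2 ℕ.* (d ℕ.* double K ℕ.+ K)                  ∎) size)
  K≤r : K ℕ.≤ r
  K≤r = ℕ.m+n≤o⇒m≤o∸n K (subst (ℕ._≤ n) (ℕ.+-comm (d ℕ.* double K) K) halved)
  length≡n : Chain.length q r d ≡ n
  length≡n = trans (Chain.length≡ q r d) (ℕ.m+[n∸m]≡n (ℕ.m+n≤o⇒m≤o (d ℕ.* double K) halved))

theorem1p6 : {c ℓ : Level} (n m d : ℕ) → 1 ℕ.≤ n → 2 ℕ.≤ m → 2 ∣ m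
  → 2 ℕ.* m ℕ.* d ℕ.+ m ℕ.≤ 2 ℕ.* n
  → (S : Subset n) → ∣ S ∣ ≡ d
  → Σ (Point n → ℚ) λ μ → Σ (Point n → Bool) λ h →
      (∀ x → 0ℚ ≤ μ x)
      × (∀ x → ¬ InW m x → μ x ≡ 0ℚ)
      × (sumℚ n μ ≡ 1ℚ)
      × ((M : Module ℚring c ℓ) (f : Point n → Module.Carrierᴹ M) → HasDegree M f d
          → Module._≈ᴹ_ M (fourier M f S) (sumᴹ M n (λ x → Module._*ₗ_ M (μ x * signℚ (h x)) (f x))))
theorem1p6 n m d _ 2≤m 2∣m size S ∣S∣≡d =
  μ , h , nonneg , supported , mass ,
  λ M f (vanishes-above-d , _) → Expansion.coefficient-as-integral M d S (signed μ h) moments f vanishes-above-d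
  where open Representing (representing n m d 2≤m 2∣m size S ∣S∣≡d)
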